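{- Let $L/\mathbb{Q}$ be a Galois extension with $[L:\mathbb{Q}] = 4$. Then for any irrational $v \in L$ there exists a primitive element $\alpha$ of $L$ such that $$\deg_\alpha(v) = [L : \mathbb{Q}(v)].$$
   Context: A primitive element of a number field $L$ of degree $n$ is an $\alpha \in L$ with $\mathbb{Q}(\alpha) = L$. For such $\alpha$, every $v \in L$ can be written uniquely as $v = f(\alpha)$ with $f \in \mathbb{Q}[x]$, $\deg f \leq n-1$; the degree of $v$ with respect to $\alpha$, $\deg_\alpha(v)$, is $\deg f$. -}

module Defs where

open import Data.Nat using (ℕ; zero; suc; _<_)
import Data.Nat as ℕ
open import Data.Fin using (Fin; toℕ)
import Data.Fin as F
open import Data.Rational as Q using (ℚ; 0ℚ)
open import Data.Vec using (Vec; zipWith; map; replicate)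
open import Data.List using (List; []; _∷_)
open import Data.Product using (Σ; ∃; _×_; _,_)
open import Relation.Binary.PropositionalEquality using (_≡_; _≢_)
open import Relation.Nullary using (¬_)

-- A number field of degree 4 is modelled (up to isomorphism) as the
-- ℚ-vector space ℚ⁴ with a bilinear multiplication given by structure
-- constants, satisfying the field axioms.

V : Set
V = Vec ℚ 4

_⊕_ : V → V → V
_⊕_ = zipWith Q._+_

_•_ : ℚ → V → V
q • x = map (q Q.*_) x

𝟘 : V
𝟘 = replicate 4 0ℚ

coord : V → Fin 4 → ℚ
coord x i = Data.Vec.lookup x i

sumV : {n : ℕ} → (Fin n → V) → V
sumV {zero}  f = 𝟘
sumV {suc n} f = f F.zero ⊕ sumV (λ i → f (F.suc i))

-- multiplication from a structure-constant table T i j = eᵢ · eⱼ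
mulT : (Fin 4 → Fin 4 → V) → V → V → V
mulT T x y = sumV (λ i → sumV (λ j → (coord x i Q.* coord y j) • T i j))

record QuarticField : Set where
  field
    table  : Fin 4 → Fin 4 → V
    one    : V
  _·_ : V → V → V
  _·_ = mulT table
  field
    one≢0   : one ≢ 𝟘
    ·-comm  : ∀ x y → x · y ≡ y · x
    ·-assoc : ∀ x y z → (x · y) · z ≡ x · (y · z)
    ·-unit  : ∀ x → one · x ≡ x
    ·-inv   : ∀ x → x ≢ 𝟘 → ∃ λ y → x · y ≡ one

module _ (L : QuarticField) where
  open QuarticField L

  IsRational : V → Set
  IsRational v = ∃ λ (q : ℚ) → v ≡ q • one

  pow : V → ℕ → V
  pow x zero    = one
  pow x (suc n) = x · pow x n

  -- evaluation of a polynomial (coefficient list, constant term first)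
  evalPoly : List ℚ → V → V
  evalPoly []       x = 𝟘
  evalPoly (c ∷ cs) x = (c • one) ⊕ (x · evalPoly cs x)

  -- ℚ(x) = ℚ[x] = { f(x) : f ∈ ℚ[X] }  (x algebraic)
  InAdj : V → V → Set
  InAdj x w = ∃ λ (f : List ℚ) → w ≡ evalPoly f x

  Subset : Set₁
  Subset = V → Set

  LinIndep : {d : ℕ} → (Fin d → V) → Set
  LinIndep {d} b = ∀ (c : Fin d → ℚ) → sumV (λ i → c i • b i) ≡ 𝟘 → ∀ i → c i ≡ 0ℚ

  Spans : {d : ℕ} → (Fin d → V) → Subset → Set
  Spans {d} b S = ∀ w → S w → ∃ λ (c : Fin d → ℚ) → w ≡ sumV (λ i → c i • b i)

  HasDim : Subset → ℕ → Set
  HasDim S d = Σ (Fin d → V) λ b → (∀ i → S (b i)) × LinIndep b × Spans b S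

  -- [L : ℚ(v)] = e, via the tower law: [ℚ(v):ℚ] · e = [L:ℚ] = 4
  FieldIndex : V → ℕ → Set
  FieldIndex v e = ∃ λ d → HasDim (InAdj v) d × (d ℕ.* e ≡ 4)

  Primitive : V → Set
  Primitive α = ∀ w → InAdj α w

  -- deg_α(v) = k : v = Σ_{i ≤ 3} cᵢ αⁱ with c_k ≠ 0 and cᵢ = 0 for i > k
  -- (the representation is unique when α is primitive)
  DegWrt : V → V → ℕ → Set
  DegWrt α v k = Σ (Fin 4 → ℚ) λ c →
      (v ≡ sumV (λ i → c i • pow α (toℕ i)))
    × (Σ (Fin 4) λ i → (toℕ i ≡ k) × (c i ≢ 0ℚ) × (∀ j → toℕ i < toℕ j → c j ≡ 0ℚ))

  IsAut : (V → V) → Set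
  IsAut σ = (∀ x y → σ (x ⊕ y) ≡ σ x ⊕ σ y)
          × (∀ (q : ℚ) x → σ (q • x) ≡ q • σ x)
          × (∀ x y → σ (x · y) ≡ σ x · σ y)
          × (σ one ≡ one)
          × (Σ (V → V) λ τ → (∀ x → τ (σ x) ≡ x) × (∀ x → σ (τ x) ≡ x))

  -- L/ℚ Galois: |Aut(L/ℚ)| = [L:ℚ] = 4 (there are always at most 4,
  -- so it suffices to ask for 4 pairwise distinct automorphisms)
  IsGalois : Set
  IsGalois = Σ (Fin 4 → (V → V)) λ σ →
      (∀ i → IsAut (σ i))
    × (∀ i j → i ≢ j → ∃ λ w → σ i w ≢ σ j w)

{-# OPTIONS --safe #-}
-- Then ℚ(v) = ℚ[v] has dimension 2 or 4: if it had dimension 3, it would be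
-- a hyperplane of L stable under multiplication by v, so v would act on L/ℚ(v) as some c ∈ ℚ, and the
-- nonzero element v - c would map L into ℚ(v), which is impossible for an invertible element.
-- If ℚ(v) = L, take α = v.  If [ℚ(v) : ℚ] = 2, then ℚ(v) = K = ℚ(s) with s² = D ∈ ℚ not a square.
-- Completing the square over K gives t ∉ K with t² ∈ K, and α = t, or α = t(1 + s) if t² ∈ ℚ,
-- has α² ∈ K ∖ ℚ.  Then K = ℚ(α²), so v = a α² + b with a ≠ 0, and sα, α, s, 1 is a basis of L
-- contained in ℚ[α], so α is primitive.
module Submission where

open import Defs
open import Data.Product using (Σ; ∃; _×_)
open import Relation.Nullary using (¬_)

open import Algebra.Bundles using (CommutativeRing)
open import Algebra.Structures using (IsCommutativeRing)
import Algebra.Solver.Ring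
import Algebra.Solver.Ring.AlmostCommutativeRing as ACR
open import Data.Empty using (⊥-elim)
open import Data.Fin as F using (Fin; punchIn; punchOut)
open import Data.Fin.Properties using (punchIn-punchOut; all?; ¬∀⟶∃¬) renaming (_≟_ to _≟ᶠ_)
open import Data.Maybe using (Maybe; just; nothing)
open import Data.Nat as ℕ using (ℕ; zero; suc; s≤s; z≤n)
open import Data.Nat.Properties using (≤-refl)
open import Data.Product using (∃-syntax; _,_; proj₁; proj₂)
import Data.Product as Product
open import Data.Rational as Q using (ℚ; 0ℚ; 1ℚ; ½; _+_; _*_; -_; _-_; 1/_; NonZero; ≢-nonZero)
open import Data.Rational.Properties as QP using (_≟_)
open import Data.Rational.Solver using (module +-*-Solver)
open import Data.Sum using (_⊎_; inj₁; inj₂)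
import Data.Sum as Sum
open import Data.Vec as Vec using (Vec; tabulate)
open import Data.Vec.Properties
  using ( lookup-zipWith; lookup-map; lookup-replicate; lookup∘tabulate; tabulate∘lookup; tabulate-cong
        ; zipWith-assoc; zipWith-comm; zipWith-identityˡ; zipWith-identityʳ; zipWith-inverseˡ; zipWith-inverseʳ; ≡-dec)
open import Data.Vec.Functional using (_∷_; [])
open import Data.List as List using (List) renaming (_∷_ to _∷ₗ_; [] to []ₗ)
open import Function using (id; _∘_)
open import Relation.Binary.PropositionalEquality
open import Relation.Nullary using (Dec; yes; no)
import Relation.Binary.Reflection as Reflection
open import Algebra.Properties.Group QP.+-0-group using () renaming (x∙y⁻¹≈ε⇒x≈y to p-q≡0⇒p≡q)
open import Algebra.Properties.Semiring.Sum (CommutativeRing.semiring QP.+-*-commutativeRing)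
  using (sum; sum-cong-≗; sum-replicate-zero; ∑-distrib-+; ∑-comm; *-distribˡ-sum; *-distribʳ-sum)
open ≡-Reasoning

module RowReduction where
  open +-*-Solver

  Matrix : ℕ → ℕ → Set
  Matrix n m = Fin n → Fin m → ℚ

  module _ {n m : ℕ} (a : Matrix n m) where

    IsRowRelation : (Fin n → ℚ) → Set
    IsRowRelation c = ∀ l → sum (λ i → c i * a i l) ≡ 0ℚ

    RowsIndependent : Set
    RowsIndependent = ∀ c → IsRowRelation c → ∀ i → c i ≡ 0ℚ

    RowsDependent : Set
    RowsDependent = ∃[ c ] IsRowRelation c × ∃[ i ] c i ≢ 0ℚ

  sum-zero : ∀ {n} (f : Fin n → ℚ) → (∀ i → f i ≡ 0ℚ) → sum f ≡ 0ℚ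
  sum-zero {n} f f≡0 = trans (sum-cong-≗ f≡0) (sum-replicate-zero n)

  *-cancelʳ-≡0 : ∀ {c x} → x ≢ 0ℚ → c * x ≡ 0ℚ → c ≡ 0ℚ
  *-cancelʳ-≡0 {c} {x} x≢0 cx≡0 = begin
    c                ≡⟨ sym (QP.*-identityʳ c) ⟩
    c * 1ℚ           ≡⟨ cong (c *_) (sym (QP.*-inverseʳ x)) ⟩
    c * (x * 1/ x)   ≡⟨ solve 3 (λ c x y → c :* (x :* y) := (c :* x) :* y) refl c x (1/ x) ⟩
    (c * x) * 1/ x   ≡⟨ cong (_* 1/ x) cx≡0 ⟩
    0ℚ * 1/ x        ≡⟨ QP.*-zeroˡ (1/ x) ⟩
    0ℚ               ∎
    where instance _ = ≢-nonZero x≢0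

  zero-or-pivot : ∀ {m} (f : Fin m → ℚ) → (∀ l → f l ≡ 0ℚ) ⊎ ∃[ l ] f l ≢ 0ℚ
  zero-or-pivot f with all? (λ l → f l ≟ 0ℚ)
  ... | yes f≡0 = inj₁ f≡0
  ... | no f≢0  = inj₂ (¬∀⟶∃¬ _ _ (λ l → f l ≟ 0ℚ) f≢0)

  zeroRow⇒dependent : ∀ {n m} (a : Matrix (suc n) m) → (∀ l → a F.zero l ≡ 0ℚ) → RowsDependent a
  zeroRow⇒dependent a a₀≡0 = c , relation , F.zero , λ ()
    where
    c : Fin _ → ℚ
    c F.zero    = 1ℚ
    c (F.suc _) = 0ℚ
    relation : IsRowRelation a c
    relation l = cong₂ _+_ (cong (1ℚ *_) (a₀≡0 l))
                           (sum-zero (λ j → 0ℚ * a (F.suc j) l) (λ j → QP.*-zeroˡ (a (F.suc j) l)))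

  module Pivot {n m} (a : Matrix (suc n) (suc m)) (k : Fin (suc m)) (a₀ₖ≢0 : a F.zero k ≢ 0ℚ) where

    private instance _ = ≢-nonZero a₀ₖ≢0

    multiplier : Fin n → ℚ
    multiplier j = a (F.suc j) k * 1/ a F.zero k

    eliminated : Matrix n (suc m)
    eliminated j l = a (F.suc j) l - multiplier j * a F.zero l

    eliminated-pivot : ∀ j → eliminated j k ≡ 0ℚ
    eliminated-pivot j = begin
      A - A * i * a₀ₖ     ≡⟨ solve 3 (λ A i x → A :- A :* i :* x := A :- A :* (x :* i)) refl A i a₀ₖ ⟩
      A - A * (a₀ₖ * i)   ≡⟨ cong (λ y → A - A * y) (QP.*-inverseʳ a₀ₖ) ⟩
      A - A * 1ℚ          ≡⟨ solve 1 (λ A → A :- A :* con 1ℚ := con 0ℚ) refl A ⟩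
      0ℚ                  ∎
      where A = a (F.suc j) k; a₀ₖ = a F.zero k; i = 1/ a F.zero k

    reduced : Matrix n m
    reduced j l = eliminated j (punchIn k l)

    row-combination : ∀ (c : Fin (suc n) → ℚ) l →
      sum (λ i → c i * a i l) ≡
      sum (λ j → c (F.suc j) * eliminated j l) + (c F.zero + sum (λ j → c (F.suc j) * multiplier j)) * a F.zero l
    row-combination c l = begin
      c₀ * a₀ + sum (λ j → d j * a (F.suc j) l)
        ≡⟨ cong (c₀ * a₀ +_) (sum-cong-≗ λ j →
             solve 4 (λ d A μ a₀ → d :* A := d :* (A :- μ :* a₀) :+ d :* μ :* a₀) refl (d j) (a (F.suc j) l) (multiplier j) a₀) ⟩
      c₀ * a₀ + sum (λ j → d j * eliminated j l + d j * multiplier j * a₀)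
        ≡⟨ cong (c₀ * a₀ +_) (∑-distrib-+ (λ j → d j * eliminated j l) (λ j → d j * multiplier j * a₀)) ⟩
      c₀ * a₀ + (sum (λ j → d j * eliminated j l) + sum (λ j → d j * multiplier j * a₀))
        ≡⟨ cong (λ y → c₀ * a₀ + (sum (λ j → d j * eliminated j l) + y)) (sym (*-distribʳ-sum a₀ (λ j → d j * multiplier j))) ⟩
      c₀ * a₀ + (sum (λ j → d j * eliminated j l) + sum (λ j → d j * multiplier j) * a₀)
        ≡⟨ solve 4 (λ c₀ a₀ E M → c₀ :* a₀ :+ (E :+ M :* a₀) := E :+ (c₀ :+ M) :* a₀)
                   refl c₀ a₀ (sum (λ j → d j * eliminated j l)) (sum (λ j → d j * multiplier j)) ⟩
      sum (λ j → d j * eliminated j l) + (c₀ + sum (λ j → d j * multiplier j)) * a₀ ∎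
      where c₀ = c F.zero; d = λ j → c (F.suc j); a₀ = a F.zero l

    pivot-column-vanishes : ∀ (d : Fin n → ℚ) → sum (λ j → d j * eliminated j k) ≡ 0ℚ
    pivot-column-vanishes d = sum-zero (λ j → d j * eliminated j k) (λ j → trans (cong (d j *_) (eliminated-pivot j)) (QP.*-zeroʳ (d j)))

    eliminated-relation : ∀ d → IsRowRelation reduced d → IsRowRelation eliminated d
    eliminated-relation d rel l with k ≟ᶠ l
    ... | yes refl = pivot-column-vanishes d
    ... | no k≢l   = subst (λ l → sum (λ j → d j * eliminated j l) ≡ 0ℚ) (punchIn-punchOut k≢l) (rel (punchOut k≢l))

    dependent-lift : RowsDependent reduced → RowsDependent a
    dependent-lift (d , rel , j , dⱼ≢0) = c , relation , F.suc j , dⱼ≢0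
      where
      M = sum (λ j → d j * multiplier j)
      c : Fin (suc n) → ℚ
      c F.zero    = - M
      c (F.suc j) = d j
      relation : IsRowRelation a c
      relation l = begin
        sum (λ i → c i * a i l)
          ≡⟨ row-combination c l ⟩
        sum (λ j → d j * eliminated j l) + (- M + M) * a F.zero l
          ≡⟨ cong₂ (λ x y → x + y * a F.zero l) (eliminated-relation d rel l) (QP.+-inverseˡ M) ⟩
        0ℚ + 0ℚ * a F.zero l
          ≡⟨ solve 1 (λ x → con 0ℚ :+ con 0ℚ :* x := con 0ℚ) refl (a F.zero l) ⟩
        0ℚ ∎

    independent-lift : RowsIndependent reduced → RowsIndependent a
    independent-lift ind c rel = λ { F.zero → c₀≡0 ; (F.suc j) → d≡0 j }
      where
      d = λ j → c (F.suc j)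
      M = sum (λ j → d j * multiplier j)
      E = λ l → sum (λ j → d j * eliminated j l)
      c₀+M≡0 : c F.zero + M ≡ 0ℚ
      c₀+M≡0 = *-cancelʳ-≡0 a₀ₖ≢0 (begin
        (c F.zero + M) * a F.zero k          ≡⟨ sym (QP.+-identityˡ _) ⟩
        0ℚ + (c F.zero + M) * a F.zero k     ≡⟨ cong (_+ (c F.zero + M) * a F.zero k) (sym (pivot-column-vanishes d)) ⟩
        E k + (c F.zero + M) * a F.zero k    ≡⟨ sym (row-combination c k) ⟩
        sum (λ i → c i * a i k)              ≡⟨ rel k ⟩
        0ℚ                                   ∎)
      d≡0 : ∀ j → d j ≡ 0ℚ
      d≡0 = ind d λ l → let l′ = punchIn k l in begin
        E l′                                ≡⟨ solve 2 (λ e x → e := e :+ con 0ℚ :* x) refl (E l′) (a F.zero l′) ⟩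
        E l′ + 0ℚ * a F.zero l′             ≡⟨ cong (λ y → E l′ + y * a F.zero l′) (sym c₀+M≡0) ⟩
        E l′ + (c F.zero + M) * a F.zero l′ ≡⟨ sym (row-combination c l′) ⟩
        sum (λ i → c i * a i l′)            ≡⟨ rel l′ ⟩
        0ℚ                                  ∎
      M-terms≡0 : ∀ j → d j * multiplier j ≡ 0ℚ
      M-terms≡0 j = trans (cong (_* multiplier j) (d≡0 j)) (QP.*-zeroˡ (multiplier j))
      c₀≡0 : c F.zero ≡ 0ℚ
      c₀≡0 = begin
        c F.zero        ≡⟨ sym (QP.+-identityʳ _) ⟩
        c F.zero + 0ℚ   ≡⟨ cong (c F.zero +_) (sum-zero (λ j → d j * multiplier j) M-terms≡0) ⟨
        c F.zero + M    ≡⟨ c₀+M≡0 ⟩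
        0ℚ              ∎

  rows-independent-or-dependent : ∀ {n m} (a : Matrix n m) → RowsIndependent a ⊎ RowsDependent a
  rows-independent-or-dependent {zero} a = inj₁ (λ _ _ ())
  rows-independent-or-dependent {suc n} a with zero-or-pivot (a F.zero)
  ... | inj₁ a₀≡0 = inj₂ (zeroRow⇒dependent a a₀≡0)
  rows-independent-or-dependent {suc n} {suc m} a | inj₂ (k , a₀ₖ≢0) =
    Sum.map independent-lift dependent-lift (rows-independent-or-dependent reduced)
    where open Pivot a k a₀ₖ≢0

  more-rows-than-columns⇒dependent : ∀ {n m} (a : Matrix n m) → m ℕ.< n → RowsDependent a
  more-rows-than-columns⇒dependent {suc n} a m<n with zero-or-pivot (a F.zero)
  ... | inj₁ a₀≡0 = zeroRow⇒dependent a a₀≡0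
  more-rows-than-columns⇒dependent {suc n} {suc m} a (s≤s m<n) | inj₂ (k , a₀ₖ≢0) =
    dependent-lift (more-rows-than-columns⇒dependent reduced m<n)
    where open Pivot a k a₀ₖ≢0

open RowReduction

module Coordinates where
  open +-*-Solver

  coord-⊕ : ∀ x y k → coord (x ⊕ y) k ≡ coord x k + coord y k
  coord-⊕ x y k = lookup-zipWith _+_ k x y

  coord-• : ∀ q x k → coord (q • x) k ≡ q * coord x k
  coord-• q x k = lookup-map k (q *_) x

  coord-𝟘 : ∀ k → coord 𝟘 k ≡ 0ℚ
  coord-𝟘 k = lookup-replicate k 0ℚ

  ⊖_ : V → V
  ⊖ x = Vec.map -_ x

  coord-⊖ : ∀ x k → coord (⊖ x) k ≡ - coord x k
  coord-⊖ x k = lookup-map k -_ x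

  coord-sumV : ∀ {n} (f : Fin n → V) k → coord (sumV f) k ≡ sum (λ i → coord (f i) k)
  coord-sumV {zero}  f k = coord-𝟘 k
  coord-sumV {suc n} f k = trans (coord-⊕ (f F.zero) _ k) (cong (coord (f F.zero) k +_) (coord-sumV (λ i → f (F.suc i)) k))

  coord-injective : ∀ {x y} → (∀ k → coord x k ≡ coord y k) → x ≡ y
  coord-injective {x} {y} x≗y = trans (sym (tabulate∘lookup x)) (trans (tabulate-cong x≗y) (tabulate∘lookup y))

  lincomb : ∀ {n} → (Fin n → ℚ) → (Fin n → V) → V
  lincomb c b = sumV (λ i → c i • b i)

  coordMatrix : ∀ {n} → (Fin n → V) → Matrix n 4
  coordMatrix b i k = coord (b i) k

  coord-lincomb : ∀ {n} (c : Fin n → ℚ) b k → coord (lincomb c b) k ≡ sum (λ i → c i * coordMatrix b i k)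
  coord-lincomb c b k = trans (coord-sumV (λ i → c i • b i) k) (sum-cong-≗ (λ i → coord-• (c i) (b i) k))

  lincomb≡𝟘⇒relation : ∀ {n} (c : Fin n → ℚ) b → lincomb c b ≡ 𝟘 → IsRowRelation (coordMatrix b) c
  lincomb≡𝟘⇒relation c b eq k = trans (sym (coord-lincomb c b k)) (trans (cong (λ x → coord x k) eq) (coord-𝟘 k))

  relation⇒lincomb≡𝟘 : ∀ {n} (c : Fin n → ℚ) b → IsRowRelation (coordMatrix b) c → lincomb c b ≡ 𝟘
  relation⇒lincomb≡𝟘 c b rel = coord-injective λ k → trans (coord-lincomb c b k) (trans (rel k) (sym (coord-𝟘 k)))

  record _∈span_ {n} (w : V) (b : Fin n → V) : Set where
    constructor span
    field
      coefficients : Fin n → ℚ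
      expansion    : w ≡ lincomb coefficients b

  ∈span-by-coords : ∀ {n} {w} {b : Fin n → V} c → (∀ k → coord w k ≡ sum (λ i → c i * coordMatrix b i k)) → w ∈span b
  ∈span-by-coords {b = b} c w≗ = span c (coord-injective λ k → trans (w≗ k) (sym (coord-lincomb c b k)))

  unitCoeffs : ∀ {n} → Fin n → Fin n → ℚ
  unitCoeffs F.zero    F.zero    = 1ℚ
  unitCoeffs F.zero    (F.suc _) = 0ℚ
  unitCoeffs (F.suc _) F.zero    = 0ℚ
  unitCoeffs (F.suc i) (F.suc j) = unitCoeffs i j

  unitCoeffs-sym : ∀ {n} (i j : Fin n) → unitCoeffs i j ≡ unitCoeffs j i
  unitCoeffs-sym F.zero    F.zero    = refl
  unitCoeffs-sym F.zero    (F.suc _) = refl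
  unitCoeffs-sym (F.suc _) F.zero    = refl
  unitCoeffs-sym (F.suc i) (F.suc j) = unitCoeffs-sym i j

  sum-unitCoeffs : ∀ {n} i (f : Fin n → ℚ) → sum (λ j → unitCoeffs i j * f j) ≡ f i
  sum-unitCoeffs F.zero f = begin
    1ℚ * f F.zero + sum (λ j → 0ℚ * f (F.suc j)) ≡⟨ cong (1ℚ * f F.zero +_) (sum-zero _ (λ j → QP.*-zeroˡ (f (F.suc j)))) ⟩
    1ℚ * f F.zero + 0ℚ                           ≡⟨ solve 1 (λ x → con 1ℚ :* x :+ con 0ℚ := x) refl (f F.zero) ⟩
    f F.zero                                     ∎
  sum-unitCoeffs (F.suc i) f = begin
    0ℚ * f F.zero + sum (λ j → unitCoeffs i j * f (F.suc j)) ≡⟨ cong (0ℚ * f F.zero +_) (sum-unitCoeffs i (λ j → f (F.suc j))) ⟩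
    0ℚ * f F.zero + f (F.suc i)                              ≡⟨ solve 2 (λ x y → con 0ℚ :* x :+ y := y) refl (f F.zero) (f (F.suc i)) ⟩
    f (F.suc i)                                              ∎

  ∈span-member : ∀ {n} (b : Fin n → V) i → b i ∈span b
  ∈span-member b i = ∈span-by-coords (unitCoeffs i) λ k → sym (sum-unitCoeffs i (λ j → coord (b j) k))

  𝟘∈span : ∀ {n} (b : Fin n → V) → 𝟘 ∈span b
  𝟘∈span b = ∈span-by-coords (λ _ → 0ℚ) λ k → trans (coord-𝟘 k) (sym (sum-zero _ λ i → QP.*-zeroˡ (coord (b i) k)))

  ∈span-⊕ : ∀ {n} {b : Fin n → V} {x y} → x ∈span b → y ∈span b → (x ⊕ y) ∈span b
  ∈span-⊕ {b = b} {x} {y} (span c refl) (span d refl) = ∈span-by-coords (λ i → c i + d i) λ k → begin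
    coord (lincomb c b ⊕ lincomb d b) k                                         ≡⟨ coord-⊕ (lincomb c b) (lincomb d b) k ⟩
    coord (lincomb c b) k + coord (lincomb d b) k                               ≡⟨ cong₂ _+_ (coord-lincomb c b k) (coord-lincomb d b k) ⟩
    sum (λ i → c i * coordMatrix b i k) + sum (λ i → d i * coordMatrix b i k)
      ≡⟨ ∑-distrib-+ (λ i → c i * coordMatrix b i k) (λ i → d i * coordMatrix b i k) ⟨
    sum (λ i → c i * coordMatrix b i k + d i * coordMatrix b i k)
      ≡⟨ sum-cong-≗ (λ i → solve 3 (λ c d x → c :* x :+ d :* x := (c :+ d) :* x) refl (c i) (d i) (coordMatrix b i k)) ⟩
    sum (λ i → (c i + d i) * coordMatrix b i k)                                 ∎

  ∈span-• : ∀ {n} {b : Fin n → V} {x} q → x ∈span b → (q • x) ∈span b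
  ∈span-• {b = b} q (span c refl) = ∈span-by-coords (λ i → q * c i) λ k → begin
    coord (q • lincomb c b) k                     ≡⟨ coord-• q (lincomb c b) k ⟩
    q * coord (lincomb c b) k                     ≡⟨ cong (q *_) (coord-lincomb c b k) ⟩
    q * sum (λ i → c i * coordMatrix b i k)       ≡⟨ *-distribˡ-sum q (λ i → c i * coordMatrix b i k) ⟩
    sum (λ i → q * (c i * coordMatrix b i k))     ≡⟨ sum-cong-≗ (λ i → sym (QP.*-assoc q (c i) (coordMatrix b i k))) ⟩
    sum (λ i → q * c i * coordMatrix b i k)       ∎

  lincomb-trans : ∀ {n m} (d : Fin n → ℚ) (C : Fin n → Fin m → ℚ) (a : Fin m → V) →
    lincomb d (λ i → lincomb (C i) a) ≡ lincomb (λ j → sum (λ i → d i * C i j)) a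
  lincomb-trans d C a = coord-injective λ k → begin
    coord (lincomb d (λ i → lincomb (C i) a)) k                  ≡⟨ coord-lincomb d (λ i → lincomb (C i) a) k ⟩
    sum (λ i → d i * coord (lincomb (C i) a) k)                  ≡⟨ sum-cong-≗ (λ i → cong (d i *_) (coord-lincomb (C i) a k)) ⟩
    sum (λ i → d i * sum (λ j → C i j * coordMatrix a j k))
      ≡⟨ sum-cong-≗ (λ i → trans (*-distribˡ-sum (d i) (λ j → C i j * coordMatrix a j k))
                                 (sum-cong-≗ λ j → sym (QP.*-assoc (d i) (C i j) (coordMatrix a j k)))) ⟩
    sum (λ i → sum (λ j → d i * C i j * coordMatrix a j k))      ≡⟨ ∑-comm (λ i j → d i * C i j * coordMatrix a j k) ⟩
    sum (λ j → sum (λ i → d i * C i j * coordMatrix a j k))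
      ≡⟨ sum-cong-≗ (λ j → sym (*-distribʳ-sum (coordMatrix a j k) (λ i → d i * C i j))) ⟩
    sum (λ j → sum (λ i → d i * C i j) * coordMatrix a j k)      ≡⟨ coord-lincomb (λ j → sum (λ i → d i * C i j)) a k ⟨
    coord (lincomb (λ j → sum (λ i → d i * C i j)) a) k          ∎

  lincomb-cong : ∀ {n} {c d : Fin n → ℚ} {a b : Fin n → V} →
                 (∀ i → c i ≡ d i) → (∀ i → a i ≡ b i) → lincomb c a ≡ lincomb d b
  lincomb-cong {zero}  c≗d a≗b = refl
  lincomb-cong {suc n} c≗d a≗b =
    cong₂ _⊕_ (cong₂ _•_ (c≗d F.zero) (a≗b F.zero)) (lincomb-cong (λ i → c≗d (F.suc i)) (λ i → a≗b (F.suc i)))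

  lincomb-zero : ∀ {n} (a : Fin n → V) → lincomb (λ _ → 0ℚ) a ≡ 𝟘
  lincomb-zero a = relation⇒lincomb≡𝟘 (λ _ → 0ℚ) a λ k → sum-zero _ λ i → QP.*-zeroˡ (coord (a i) k)

  lincomb-substitute : ∀ {n m} {a : Fin m → V} {b : Fin n → V} (b⊆a : ∀ i → b i ∈span a) (d : Fin n → ℚ) →
    lincomb d b ≡ lincomb (λ j → sum (λ i → d i * _∈span_.coefficients (b⊆a i) j)) a
  lincomb-substitute {a = a} {b} b⊆a d = begin
    lincomb d b                         ≡⟨ lincomb-cong {c = d} (λ _ → refl) (λ i → _∈span_.expansion (b⊆a i)) ⟩
    lincomb d (λ i → lincomb (C i) a)   ≡⟨ lincomb-trans d C a ⟩
    lincomb (λ j → sum (λ i → d i * C i j)) a ∎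
    where C = λ i → _∈span_.coefficients (b⊆a i)

  ∈span-trans : ∀ {n m} {a : Fin m → V} {b : Fin n → V} {w} → (∀ i → b i ∈span a) → w ∈span b → w ∈span a
  ∈span-trans b⊆a (span c refl) = span (λ j → sum (λ i → c i * _∈span_.coefficients (b⊆a i) j)) (lincomb-substitute b⊆a c)

  standardBasis : Fin 4 → V
  standardBasis i = tabulate (unitCoeffs i)

open Coordinates

module LinearAlgebra (L : QuarticField) where
  open +-*-Solver

  LinDep : ∀ {n} → (Fin n → V) → Set
  LinDep b = ∃[ c ] lincomb c b ≡ 𝟘 × ∃[ i ] c i ≢ 0ℚ

  independent-or-dependent : ∀ {n} (b : Fin n → V) → LinIndep L b ⊎ LinDep b
  independent-or-dependent b = Sum.map
    (λ ind c eq → ind c (lincomb≡𝟘⇒relation c b eq))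
    (λ (c , rel , nz) → c , relation⇒lincomb≡𝟘 c b rel , nz)
    (rows-independent-or-dependent (coordMatrix b))

  more-than-four⇒dependent : ∀ {n} (b : Fin n → V) → 4 ℕ.< n → LinDep b
  more-than-four⇒dependent b 4<n with more-rows-than-columns⇒dependent (coordMatrix b) 4<n
  ... | c , rel , nz = c , relation⇒lincomb≡𝟘 c b rel , nz

  standardBasis-independent : LinIndep L standardBasis
  standardBasis-independent c eq k = begin
    c k                                                 ≡⟨ sum-unitCoeffs k c ⟨
    sum (λ i → unitCoeffs k i * c i)
      ≡⟨ sum-cong-≗ (λ i → trans (QP.*-comm (unitCoeffs k i) (c i))
                                 (cong (c i *_) (trans (unitCoeffs-sym k i) (sym (lookup∘tabulate (unitCoeffs i) k))))) ⟩
    sum (λ i → c i * coordMatrix standardBasis i k)     ≡⟨ lincomb≡𝟘⇒relation c standardBasis eq k ⟩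
    0ℚ                                                  ∎

  dependent-cons⇒∈span : ∀ {n} {a : Fin n → V} {w} → LinIndep L a → LinDep (w ∷ a) → w ∈span a
  dependent-cons⇒∈span {a = a} {w} ind (c , eq , i , cᵢ≢0) with c F.zero ≟ 0ℚ
  ... | yes c₀≡0 = ⊥-elim (cᵢ≢0 (c≡0 i))
    where
    tail≡0 : ∀ j → c (F.suc j) ≡ 0ℚ
    tail≡0 = ind (λ j → c (F.suc j)) (relation⇒lincomb≡𝟘 (λ j → c (F.suc j)) a λ k → begin
      S k                              ≡⟨ solve 2 (λ x S → S := con 0ℚ :* x :+ S) refl (coord w k) (S k) ⟩
      0ℚ * coord w k + S k             ≡⟨ cong (λ z → z * coord w k + S k) (sym c₀≡0) ⟩
      c F.zero * coord w k + S k       ≡⟨ lincomb≡𝟘⇒relation c (w ∷ a) eq k ⟩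
      0ℚ                               ∎)
      where S = λ k → sum (λ j → c (F.suc j) * coord (a j) k)
    c≡0 : ∀ i → c i ≡ 0ℚ
    c≡0 F.zero    = c₀≡0
    c≡0 (F.suc j) = tail≡0 j
  ... | no c₀≢0 = ∈span-by-coords (λ j → - 1/c₀ * c (F.suc j)) λ k → let S = sum (λ j → c (F.suc j) * coord (a j) k) in begin
    coord w k                                      ≡⟨ QP.*-identityˡ (coord w k) ⟨
    1ℚ * coord w k                                 ≡⟨ cong (_* coord w k) (QP.*-inverseˡ (c F.zero)) ⟨
    1/c₀ * c F.zero * coord w k
      ≡⟨ solve 4 (λ i c w S → i :* c :* w := i :* (c :* w :+ S) :+ (:- i) :* S) refl 1/c₀ (c F.zero) (coord w k) S ⟩
    1/c₀ * (c F.zero * coord w k + S) + - 1/c₀ * S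
      ≡⟨ cong (λ z → 1/c₀ * z + - 1/c₀ * S) (lincomb≡𝟘⇒relation c (w ∷ a) eq k) ⟩
    1/c₀ * 0ℚ + - 1/c₀ * S                         ≡⟨ solve 2 (λ i S → i :* con 0ℚ :+ (:- i) :* S := (:- i) :* S) refl 1/c₀ S ⟩
    - 1/c₀ * S                                     ≡⟨ *-distribˡ-sum (- 1/c₀) (λ j → c (F.suc j) * coord (a j) k) ⟩
    sum (λ j → - 1/c₀ * (c (F.suc j) * coord (a j) k))
      ≡⟨ sum-cong-≗ (λ j → sym (QP.*-assoc (- 1/c₀) (c (F.suc j)) (coord (a j) k))) ⟩
    sum (λ j → - 1/c₀ * c (F.suc j) * coord (a j) k)   ∎
    where
    instance _ = ≢-nonZero c₀≢0
    1/c₀ = 1/ c F.zero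

  independent-cons⇒∉span : ∀ {n} {a : Fin n → V} {w} → LinIndep L (w ∷ a) → ¬ w ∈span a
  independent-cons⇒∉span {a = a} {w} ind (span c w≡) =
    -1≢0 (ind (- 1ℚ ∷ c) (relation⇒lincomb≡𝟘 (- 1ℚ ∷ c) (w ∷ a) relation) F.zero)
    where
    -1≢0 : - 1ℚ ≢ 0ℚ
    -1≢0 ()
    relation : IsRowRelation (coordMatrix (w ∷ a)) (- 1ℚ ∷ c)
    relation k = begin
      - 1ℚ * coord w k + sum (λ j → c j * coord (a j) k) ≡⟨ cong (- 1ℚ * coord w k +_) (coord-lincomb c a k) ⟨
      - 1ℚ * coord w k + coord (lincomb c a) k           ≡⟨ cong (λ x → - 1ℚ * coord w k + coord x k) w≡ ⟨
      - 1ℚ * coord w k + coord w k                       ≡⟨ solve 1 (λ x → :- con 1ℚ :* x :+ x := con 0ℚ) refl (coord w k) ⟩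
      0ℚ                                                 ∎

  ∈span? : ∀ {n} {a : Fin n → V} → LinIndep L a → ∀ w → Dec (w ∈span a)
  ∈span? {a = a} ind w with independent-or-dependent (w ∷ a)
  ... | inj₁ ind′ = no (independent-cons⇒∉span ind′)
  ... | inj₂ dep  = yes (dependent-cons⇒∈span ind dep)

  ∉span⇒independent-cons : ∀ {n} {a : Fin n → V} {w} → LinIndep L a → ¬ w ∈span a → LinIndep L (w ∷ a)
  ∉span⇒independent-cons {a = a} {w} ind w∉a with independent-or-dependent (w ∷ a)
  ... | inj₁ ind′ = ind′
  ... | inj₂ dep  = ⊥-elim (w∉a (dependent-cons⇒∈span ind dep))

  independent⇒spanning : (b : Fin 4 → V) → LinIndep L b → ∀ w → w ∈span b
  independent⇒spanning b ind w = dependent-cons⇒∈span {a = b} ind (more-than-four⇒dependent (w ∷ b) ≤-refl)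

  independent-⊈-smaller-span : ∀ {m} (b : Fin 4 → V) (a : Fin m → V) → m ℕ.< 4 → LinIndep L b → ¬ (∀ i → b i ∈span a)
  independent-⊈-smaller-span b a m<4 ind b⊆a with more-rows-than-columns⇒dependent C m<4
    where C = λ i → _∈span_.coefficients (b⊆a i)
  ... | d , rel , i , dᵢ≢0 = dᵢ≢0 (ind d (begin
    lincomb d b                                 ≡⟨ lincomb-substitute b⊆a d ⟩
    lincomb (λ j → sum (λ i → d i * C i j)) a   ≡⟨ lincomb-cong {a = a} rel (λ _ → refl) ⟩
    lincomb (λ _ → 0ℚ) a                        ≡⟨ lincomb-zero a ⟩
    𝟘                                           ∎) i)
    where C = λ i → _∈span_.coefficients (b⊆a i)

  ∃∉span : ∀ {m} (a : Fin m → V) → m ℕ.< 4 → LinIndep L a → ∃[ w ] ¬ w ∈span a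
  ∃∉span a m<4 ind = pick (all? basis∈span?)
    where
    basis∈span? : ∀ i → Dec (standardBasis i ∈span a)
    basis∈span? i = ∈span? {a = a} ind (standardBasis i)
    pick : Dec (∀ i → standardBasis i ∈span a) → ∃[ w ] ¬ w ∈span a
    pick (yes basis⊆a) = ⊥-elim (independent-⊈-smaller-span standardBasis a m<4 standardBasis-independent basis⊆a)
    pick (no basis⊈a)  = Product.map standardBasis id (¬∀⟶∃¬ 4 (λ i → standardBasis i ∈span a) basis∈span? basis⊈a)

module FieldArithmetic (L : QuarticField) where
  open QuarticField L
  open +-*-Solver

  coord-· : ∀ x y k → coord (x · y) k ≡ sum (λ i → sum (λ j → coord x i * coord y j * coord (table i j) k))
  coord-· x y k =
    trans (coord-sumV (λ i → sumV (λ j → (coord x i * coord y j) • table i j)) k) (sum-cong-≗ λ i →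
    trans (coord-sumV (λ j → (coord x i * coord y j) • table i j) k) (sum-cong-≗ λ j →
    coord-• (coord x i * coord y j) (table i j) k))

  ·-distribʳ : ∀ x y z → (x ⊕ y) · z ≡ (x · z) ⊕ (y · z)
  ·-distribʳ x y z = coord-injective λ k → begin
    coord ((x ⊕ y) · z) k
      ≡⟨ coord-· (x ⊕ y) z k ⟩
    sum (λ i → sum (λ j → coord (x ⊕ y) i * coord z j * T i j k))
      ≡⟨ sum-cong-≗ (λ i → sum-cong-≗ λ j → cong (λ u → u * coord z j * T i j k) (coord-⊕ x y i)) ⟩
    sum (λ i → sum (λ j → (coord x i + coord y i) * coord z j * T i j k))
      ≡⟨ sum-cong-≗ (λ i → sum-cong-≗ λ j → solve 4 (λ a b c t → (a :+ b) :* c :* t := a :* c :* t :+ b :* c :* t)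
                                                 refl (coord x i) (coord y i) (coord z j) (T i j k)) ⟩
    sum (λ i → sum (λ j → coord x i * coord z j * T i j k + coord y i * coord z j * T i j k))
      ≡⟨ sum-cong-≗ (λ i → ∑-distrib-+ (λ j → coord x i * coord z j * T i j k) (λ j → coord y i * coord z j * T i j k)) ⟩
    sum (λ i → sum (λ j → coord x i * coord z j * T i j k) + sum (λ j → coord y i * coord z j * T i j k))
      ≡⟨ ∑-distrib-+ (λ i → sum (λ j → coord x i * coord z j * T i j k)) (λ i → sum (λ j → coord y i * coord z j * T i j k)) ⟩
    sum (λ i → sum (λ j → coord x i * coord z j * T i j k)) + sum (λ i → sum (λ j → coord y i * coord z j * T i j k))
      ≡⟨ cong₂ _+_ (coord-· x z k) (coord-· y z k) ⟨
    coord (x · z) k + coord (y · z) k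
      ≡⟨ coord-⊕ (x · z) (y · z) k ⟨
    coord ((x · z) ⊕ (y · z)) k ∎
    where T = λ i j k → coord (table i j) k

  •-·-assoc : ∀ q x y → (q • x) · y ≡ q • (x · y)
  •-·-assoc q x y = coord-injective λ k → begin
    coord ((q • x) · y) k
      ≡⟨ coord-· (q • x) y k ⟩
    sum (λ i → sum (λ j → coord (q • x) i * coord y j * T i j k))
      ≡⟨ sum-cong-≗ (λ i → sum-cong-≗ λ j → cong (λ u → u * coord y j * T i j k) (coord-• q x i)) ⟩
    sum (λ i → sum (λ j → q * coord x i * coord y j * T i j k))
      ≡⟨ sum-cong-≗ (λ i → sum-cong-≗ λ j → solve 4 (λ q a b t → q :* a :* b :* t := q :* (a :* b :* t))
                                                 refl q (coord x i) (coord y j) (T i j k)) ⟩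
    sum (λ i → sum (λ j → q * (coord x i * coord y j * T i j k)))
      ≡⟨ sum-cong-≗ (λ i → *-distribˡ-sum q (λ j → coord x i * coord y j * T i j k)) ⟨
    sum (λ i → q * sum (λ j → coord x i * coord y j * T i j k))
      ≡⟨ *-distribˡ-sum q (λ i → sum (λ j → coord x i * coord y j * T i j k)) ⟨
    q * sum (λ i → sum (λ j → coord x i * coord y j * T i j k))
      ≡⟨ cong (q *_) (coord-· x y k) ⟨
    q * coord (x · y) k
      ≡⟨ coord-• q (x · y) k ⟨
    coord (q • (x · y)) k ∎
    where T = λ i j k → coord (table i j) k

  isCommutativeRing : IsCommutativeRing _≡_ _⊕_ _·_ ⊖_ 𝟘 one
  isCommutativeRing = record
    { isRing = record
      { +-isAbelianGroup = record
        { isGroup = record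
          { isMonoid = record
            { isSemigroup = record
              { isMagma = record { isEquivalence = isEquivalence ; ∙-cong = cong₂ _⊕_ }
              ; assoc = zipWith-assoc QP.+-assoc }
            ; identity = zipWith-identityˡ QP.+-identityˡ , zipWith-identityʳ QP.+-identityʳ }
          ; inverse = zipWith-inverseˡ QP.+-inverseˡ , zipWith-inverseʳ QP.+-inverseʳ
          ; ⁻¹-cong = cong ⊖_ }
        ; comm = zipWith-comm QP.+-comm }
      ; *-cong = cong₂ _·_
      ; *-assoc = ·-assoc
      ; *-identity = ·-unit , λ x → trans (·-comm x one) (·-unit x)
      ; distrib = (λ x y z → trans (·-comm x (y ⊕ z)) (trans (·-distribʳ y z x) (cong₂ _⊕_ (·-comm y x) (·-comm z x))))
                , (λ x y z → ·-distribʳ y z x) }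
    ; *-comm = ·-comm }

  ι : ℚ → V
  ι q = q • one

  •≡ι· : ∀ q x → q • x ≡ ι q · x
  •≡ι· q x = sym (trans (•-·-assoc q one x) (cong (q •_) (·-unit x)))

  ι-+ : ∀ a b → ι (a + b) ≡ ι a ⊕ ι b
  ι-+ a b = coord-injective λ k → begin
    coord (ι (a + b)) k                 ≡⟨ coord-• (a + b) one k ⟩
    (a + b) * coord one k               ≡⟨ QP.*-distribʳ-+ (coord one k) a b ⟩
    a * coord one k + b * coord one k   ≡⟨ cong₂ _+_ (coord-• a one k) (coord-• b one k) ⟨
    coord (ι a) k + coord (ι b) k       ≡⟨ coord-⊕ (ι a) (ι b) k ⟨
    coord (ι a ⊕ ι b) k                 ∎

  •-assoc : ∀ a b x → (a * b) • x ≡ a • (b • x)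
  •-assoc a b x = coord-injective λ k → begin
    coord ((a * b) • x) k     ≡⟨ coord-• (a * b) x k ⟩
    a * b * coord x k         ≡⟨ QP.*-assoc a b (coord x k) ⟩
    a * (b * coord x k)       ≡⟨ cong (a *_) (coord-• b x k) ⟨
    a * coord (b • x) k       ≡⟨ coord-• a (b • x) k ⟨
    coord (a • (b • x)) k     ∎

  ι-* : ∀ a b → ι (a * b) ≡ ι a · ι b
  ι-* a b = begin
    (a * b) • one          ≡⟨ •-assoc a b one ⟩
    a • ι b                ≡⟨ cong (a •_) (·-unit (ι b)) ⟨
    a • (one · ι b)        ≡⟨ •-·-assoc a one (ι b) ⟨
    ι a · ι b              ∎

  ι-‿ : ∀ a → ι (- a) ≡ ⊖ ι a
  ι-‿ a = coord-injective λ k → begin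
    coord (ι (- a)) k     ≡⟨ coord-• (- a) one k ⟩
    - a * coord one k     ≡⟨ QP.neg-distribˡ-* a (coord one k) ⟨
    - (a * coord one k)   ≡⟨ cong -_ (coord-• a one k) ⟨
    - coord (ι a) k       ≡⟨ coord-⊖ (ι a) k ⟨
    coord (⊖ ι a) k       ∎

  ι-0 : ι 0ℚ ≡ 𝟘
  ι-0 = coord-injective λ k → trans (coord-• 0ℚ one k) (trans (QP.*-zeroˡ (coord one k)) (sym (coord-𝟘 k)))

  ι-1 : ι 1ℚ ≡ one
  ι-1 = coord-injective λ k → trans (coord-• 1ℚ one k) (QP.*-identityˡ (coord one k))

module RingSolver (L : QuarticField) where
  open QuarticField L
  open FieldArithmetic L

  -- The solver normalises with opaque copies of the operations: unfolding _·_ (a double sum over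
  -- the structure constants) would make its final refl infeasible.
  private
    opaque
      hiddenOps : (V → V → V) × (V → V → V) × (V → V)
      hiddenOps = _⊕_ , _·_ , ⊖_

      hiddenOps≡ : hiddenOps ≡ (_⊕_ , _·_ , ⊖_)
      hiddenOps≡ = refl

    _⊕ʰ_ _·ʰ_ : V → V → V
    _⊕ʰ_ = proj₁ hiddenOps
    _·ʰ_ = proj₁ (proj₂ hiddenOps)
    ⊖ʰ_ : V → V
    ⊖ʰ_ = proj₂ (proj₂ hiddenOps)

    ⊕ʰ≡⊕ : ∀ x y → x ⊕ʰ y ≡ x ⊕ y
    ⊕ʰ≡⊕ x y = cong (λ ops → proj₁ ops x y) hiddenOps≡
    ·ʰ≡· : ∀ x y → x ·ʰ y ≡ x · y
    ·ʰ≡· x y = cong (λ ops → proj₁ (proj₂ ops) x y) hiddenOps≡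
    ⊖ʰ≡⊖ : ∀ x → ⊖ʰ x ≡ ⊖ x
    ⊖ʰ≡⊖ x = cong (λ ops → proj₂ (proj₂ ops) x) hiddenOps≡

    hiddenRing : CommutativeRing _ _
    hiddenRing = record
      { isCommutativeRing = subst (λ (p , m , n) → IsCommutativeRing _≡_ p m n 𝟘 one) (sym hiddenOps≡) isCommutativeRing }

    ι-morphism : ACR._-Raw-AlmostCommutative⟶_ QP.+-*-rawRing (ACR.fromCommutativeRing hiddenRing)
    ι-morphism = record
      { ⟦_⟧    = ι
      ; +-homo = λ a b → trans (ι-+ a b) (sym (⊕ʰ≡⊕ (ι a) (ι b)))
      ; *-homo = λ a b → trans (ι-* a b) (sym (·ʰ≡· (ι a) (ι b)))
      ; -‿homo = λ a → trans (ι-‿ a) (sym (⊖ʰ≡⊖ (ι a)))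
      ; 0-homo = ι-0
      ; 1-homo = ι-1 }

    ι-≟ : ∀ a b → Maybe (ι a ≡ ι b)
    ι-≟ a b with a ≟ b
    ... | yes a≡b = just (cong ι a≡b)
    ... | no _    = nothing

    open module Hidden = Algebra.Solver.Ring QP.+-*-rawRing (ACR.fromCommutativeRing hiddenRing) ι-morphism ι-≟
      using (Polynomial; op; [+]; [*]; con; var; _:^_; :-_; ⟦_⟧; ⟦_⟧↓; correct)

  ⟦_⟧ᴸ : ∀ {n} → Polynomial n → Vec V n → V
  ⟦ op [+] p q ⟧ᴸ ρ = ⟦ p ⟧ᴸ ρ ⊕ ⟦ q ⟧ᴸ ρ
  ⟦ op [*] p q ⟧ᴸ ρ = ⟦ p ⟧ᴸ ρ · ⟦ q ⟧ᴸ ρ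
  ⟦ con c ⟧ᴸ      ρ = ι c
  ⟦ var x ⟧ᴸ      ρ = Vec.lookup ρ x
  ⟦ p :^ n ⟧ᴸ     ρ = pow L (⟦ p ⟧ᴸ ρ) n
  ⟦ :- p ⟧ᴸ       ρ = ⊖ ⟦ p ⟧ᴸ ρ

  private
    ⟦⟧≡⟦⟧ᴸ : ∀ {n} (p : Polynomial n) ρ → ⟦ p ⟧ ρ ≡ ⟦ p ⟧ᴸ ρ
    ⟦⟧≡⟦⟧ᴸ-^ : ∀ {n} (p : Polynomial n) ρ k → ⟦ p :^ k ⟧ ρ ≡ pow L (⟦ p ⟧ᴸ ρ) k
    ⟦⟧≡⟦⟧ᴸ (op [+] p q) ρ = trans (⊕ʰ≡⊕ _ _) (cong₂ _⊕_ (⟦⟧≡⟦⟧ᴸ p ρ) (⟦⟧≡⟦⟧ᴸ q ρ))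
    ⟦⟧≡⟦⟧ᴸ (op [*] p q) ρ = trans (·ʰ≡· _ _) (cong₂ _·_ (⟦⟧≡⟦⟧ᴸ p ρ) (⟦⟧≡⟦⟧ᴸ q ρ))
    ⟦⟧≡⟦⟧ᴸ (con c)      ρ = refl
    ⟦⟧≡⟦⟧ᴸ (var x)      ρ = refl
    ⟦⟧≡⟦⟧ᴸ (p :^ k)     ρ = ⟦⟧≡⟦⟧ᴸ-^ p ρ k
    ⟦⟧≡⟦⟧ᴸ (:- p)       ρ = trans (⊖ʰ≡⊖ _) (cong ⊖_ (⟦⟧≡⟦⟧ᴸ p ρ))
    ⟦⟧≡⟦⟧ᴸ-^ p ρ zero    = refl
    ⟦⟧≡⟦⟧ᴸ-^ p ρ (suc k) = trans (·ʰ≡· _ _) (cong₂ _·_ (⟦⟧≡⟦⟧ᴸ p ρ) (⟦⟧≡⟦⟧ᴸ-^ p ρ k))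

  open Reflection (setoid V) var ⟦_⟧ᴸ ⟦_⟧↓ (λ p ρ → trans (correct p ρ) (⟦⟧≡⟦⟧ᴸ p ρ)) public
    using (solve) renaming (_⊜_ to _:=_)
  open Hidden public using (_:+_; _:*_; _:-_; con; :-_)

  -- ⟦ 𝟏 ⟧ᴸ is `one` itself, whereas ⟦ con 1ℚ ⟧ᴸ is ι 1ℚ.
  𝟏 : ∀ {n} → Polynomial n
  𝟏 = con 1ℚ :^ 0

module _ (L : QuarticField) where
  open QuarticField L
  open LinearAlgebra L
  open FieldArithmetic L
  open RingSolver L
  open IsCommutativeRing isCommutativeRing using (+-identityˡ; +-identityʳ; *-identityʳ; zeroˡ; zeroʳ; -‿inverseʳ)

  _≟ᵛ_ : (x y : V) → Dec (x ≡ y)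
  _≟ᵛ_ = ≡-dec _≟_

  ≡-modulo : ∀ {x y p q} → p ≡ q → ∀ m → x ≡ y ⊕ (m · (p ⊕ (⊖ q))) → x ≡ y
  ≡-modulo {y = y} {p} refl m x≡ = trans x≡ (solve 3 (λ y m p → y :+ m :* (p :- p) := y) refl y m p)

  ·-integral : ∀ {x y} → x ≢ 𝟘 → x · y ≡ 𝟘 → y ≡ 𝟘
  ·-integral {x} {y} x≢0 xy≡0 = let (x⁻¹ , xx⁻¹≡1) = ·-inv x x≢0 in begin
    y               ≡⟨ ·-unit y ⟨
    one · y         ≡⟨ cong (_· y) xx⁻¹≡1 ⟨
    (x · x⁻¹) · y   ≡⟨ solve 3 (λ x x⁻¹ y → (x :* x⁻¹) :* y := x⁻¹ :* (x :* y)) refl x x⁻¹ y ⟩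
    x⁻¹ · (x · y)   ≡⟨ cong (x⁻¹ ·_) xy≡0 ⟩
    x⁻¹ · 𝟘         ≡⟨ zeroʳ x⁻¹ ⟩
    𝟘               ∎

  x⊖y≡𝟘⇒x≡y : ∀ {x y} → x ⊕ (⊖ y) ≡ 𝟘 → x ≡ y
  x⊖y≡𝟘⇒x≡y {x} {y} x-y≡0 = begin
    x                  ≡⟨ solve 2 (λ x y → x := (x :- y) :+ y) refl x y ⟩
    (x ⊕ (⊖ y)) ⊕ y    ≡⟨ cong (_⊕ y) x-y≡0 ⟩
    𝟘 ⊕ y              ≡⟨ +-identityˡ y ⟩
    y                  ∎

  x⊕y≡𝟘⇒x≡⊖y : ∀ {x y} → x ⊕ y ≡ 𝟘 → x ≡ ⊖ y
  x⊕y≡𝟘⇒x≡⊖y {x} {y} x+y≡0 = begin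
    x                  ≡⟨ solve 2 (λ x y → x := (x :+ y) :- y) refl x y ⟩
    (x ⊕ y) ⊕ (⊖ y)    ≡⟨ cong (_⊕ (⊖ y)) x+y≡0 ⟩
    𝟘 ⊕ (⊖ y)          ≡⟨ +-identityˡ (⊖ y) ⟩
    ⊖ y                ∎

  square≡𝟘⇒≡𝟘 : ∀ {x} → x · x ≡ 𝟘 → x ≡ 𝟘
  square≡𝟘⇒≡𝟘 {x} x²≡0 with x ≟ᵛ 𝟘
  ... | yes x≡0 = x≡0
  ... | no x≢0  = ·-integral x≢0 x²≡0

  ι-inverse : ∀ q .{{_ : NonZero q}} → ι (1/ q) · ι q ≡ one
  ι-inverse q = begin
    ι (1/ q) · ι q    ≡⟨ ι-* (1/ q) q ⟨
    ι (1/ q * q)      ≡⟨ cong ι (QP.*-inverseˡ q) ⟩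
    ι 1ℚ              ≡⟨ ι-1 ⟩
    one               ∎

  ι-cancel : ∀ q .{{_ : NonZero q}} x → ι (1/ q) · (ι q · x) ≡ x
  ι-cancel q x = begin
    ι (1/ q) · (ι q · x)   ≡⟨ solve 3 (λ a b x → a :* (b :* x) := (a :* b) :* x) refl (ι (1/ q)) (ι q) x ⟩
    (ι (1/ q) · ι q) · x   ≡⟨ cong (_· x) (ι-inverse q) ⟩
    one · x                ≡⟨ ·-unit x ⟩
    x                      ∎

  ι-sub : ∀ p q → ι (p - q) ≡ ι p ⊕ (⊖ ι q)
  ι-sub p q = trans (ι-+ p (- q)) (cong (ι p ⊕_) (ι-‿ q))

  ·-•-comm : ∀ x q y → x · (q • y) ≡ q • (x · y)
  ·-•-comm x q y = trans (·-comm x (q • y)) (trans (•-·-assoc q y x) (cong (q •_) (·-comm y x)))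

  ·-lincomb : ∀ {n} x (c : Fin n → ℚ) b → x · lincomb c b ≡ lincomb c (λ i → x · b i)
  ·-lincomb {zero}  x c b = zeroʳ x
  ·-lincomb {suc n} x c b = begin
    x · ((c F.zero • b F.zero) ⊕ lincomb (λ i → c (F.suc i)) (λ i → b (F.suc i)))
      ≡⟨ solve 3 (λ x y z → x :* (y :+ z) := x :* y :+ x :* z)
                 refl x (c F.zero • b F.zero) (lincomb (λ i → c (F.suc i)) (λ i → b (F.suc i))) ⟩
    (x · (c F.zero • b F.zero)) ⊕ (x · lincomb (λ i → c (F.suc i)) (λ i → b (F.suc i)))
      ≡⟨ cong₂ _⊕_ (·-•-comm x (c F.zero) (b F.zero)) (·-lincomb x (λ i → c (F.suc i)) (λ i → b (F.suc i))) ⟩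
    (c F.zero • (x · b F.zero)) ⊕ lincomb (λ i → c (F.suc i)) (λ i → x · b (F.suc i))
      ∎

  ∈span-· : ∀ {n} {a : Fin n → V} {w} x → (∀ i → (x · a i) ∈span a) → w ∈span a → (x · w) ∈span a
  ∈span-· {a = a} x xa⊆a (span c refl) = ∈span-trans xa⊆a (span c (·-lincomb x c a))

  ∈span-ι· : ∀ {n} {b : Fin n → V} {x} q → x ∈span b → (ι q · x) ∈span b
  ∈span-ι· {b = b} {x} q x∈b = subst (_∈span b) (•≡ι· q x) (∈span-• q x∈b)

  lincomb-x-one : ∀ x (c : Fin 2 → ℚ) → lincomb c (x ∷ one ∷ []) ≡ (ι (c F.zero) · x) ⊕ ι (c (F.suc F.zero))
  lincomb-x-one x c = cong₂ _⊕_ (•≡ι· (c F.zero) x) (+-identityʳ (ι (c (F.suc F.zero))))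

  ∈span-one⇒rational : ∀ {x} → x ∈span (one ∷ []) → IsRational L x
  ∈span-one⇒rational (span c x≡) = c F.zero , trans x≡ (+-identityʳ (ι (c F.zero)))

  one-independent : LinIndep L (one ∷ [])
  one-independent c c•one≡0 F.zero with c F.zero ≟ 0ℚ
  ... | yes c₀≡0 = c₀≡0
  ... | no c₀≢0  = ⊥-elim (one≢0 (begin
    one                          ≡⟨ ι-inverse (c F.zero) ⟨
    ι (1/ c F.zero) · ι (c F.zero) ≡⟨ cong (ι (1/ c F.zero) ·_) (trans (sym (+-identityʳ (ι (c F.zero)))) c•one≡0) ⟩
    ι (1/ c F.zero) · 𝟘           ≡⟨ zeroʳ (ι (1/ c F.zero)) ⟩
    𝟘                            ∎))
    where instance _ = ≢-nonZero c₀≢0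

  irrational⇒independent : ∀ {x} → ¬ IsRational L x → LinIndep L (x ∷ one ∷ [])
  irrational⇒independent x∉ℚ = ∉span⇒independent-cons {a = one ∷ []} one-independent (x∉ℚ ∘ ∈span-one⇒rational)

  -- ℚ[x] as a subspace of L

  _+ₚ_ : List ℚ → List ℚ → List ℚ
  []ₗ      +ₚ g        = g
  (a ∷ₗ f) +ₚ []ₗ      = a ∷ₗ f
  (a ∷ₗ f) +ₚ (b ∷ₗ g) = (a + b) ∷ₗ (f +ₚ g)

  evalPoly-+ₚ : ∀ f g x → evalPoly L (f +ₚ g) x ≡ evalPoly L f x ⊕ evalPoly L g x
  evalPoly-+ₚ []ₗ      g        x = sym (+-identityˡ (evalPoly L g x))
  evalPoly-+ₚ (a ∷ₗ f) []ₗ      x = sym (+-identityʳ (evalPoly L (a ∷ₗ f) x))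
  evalPoly-+ₚ (a ∷ₗ f) (b ∷ₗ g) x = begin
    ι (a + b) ⊕ (x · evalPoly L (f +ₚ g) x)
      ≡⟨ cong₂ (λ c p → c ⊕ (x · p)) (ι-+ a b) (evalPoly-+ₚ f g x) ⟩
    (ι a ⊕ ι b) ⊕ (x · (evalPoly L f x ⊕ evalPoly L g x))
      ≡⟨ solve 5 (λ a b x p q → (a :+ b) :+ x :* (p :+ q) := (a :+ x :* p) :+ (b :+ x :* q))
                 refl (ι a) (ι b) x (evalPoly L f x) (evalPoly L g x) ⟩
    (ι a ⊕ (x · evalPoly L f x)) ⊕ (ι b ⊕ (x · evalPoly L g x))
      ∎

  evalPoly-scale : ∀ q f x → evalPoly L (List.map (q *_) f) x ≡ q • evalPoly L f x
  evalPoly-scale q []ₗ      x = sym (trans (•≡ι· q 𝟘) (zeroʳ (ι q)))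
  evalPoly-scale q (a ∷ₗ f) x = begin
    ι (q * a) ⊕ (x · evalPoly L (List.map (q *_) f) x)
      ≡⟨ cong₂ (λ c p → c ⊕ (x · p)) (ι-* q a) (trans (evalPoly-scale q f x) (•≡ι· q (evalPoly L f x))) ⟩
    (ι q · ι a) ⊕ (x · (ι q · evalPoly L f x))
      ≡⟨ solve 4 (λ q a x p → q :* a :+ x :* (q :* p) := q :* (a :+ x :* p)) refl (ι q) (ι a) x (evalPoly L f x) ⟩
    ι q · (ι a ⊕ (x · evalPoly L f x))
      ≡⟨ •≡ι· q (ι a ⊕ (x · evalPoly L f x)) ⟨
    q • (ι a ⊕ (x · evalPoly L f x))
      ∎

  module _ {x : V} where

    InAdj-𝟘 : InAdj L x 𝟘
    InAdj-𝟘 = []ₗ , refl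

    InAdj-⊕ : ∀ {u w} → InAdj L x u → InAdj L x w → InAdj L x (u ⊕ w)
    InAdj-⊕ (f , refl) (g , refl) = f +ₚ g , sym (evalPoly-+ₚ f g x)

    InAdj-• : ∀ {w} q → InAdj L x w → InAdj L x (q • w)
    InAdj-• q (f , refl) = List.map (q *_) f , sym (evalPoly-scale q f x)

    InAdj-lincomb : ∀ {n} (c : Fin n → ℚ) {b} → (∀ i → InAdj L x (b i)) → InAdj L x (lincomb c b)
    InAdj-lincomb {zero}  c b∈ = InAdj-𝟘
    InAdj-lincomb {suc n} c b∈ = InAdj-⊕ (InAdj-• (c F.zero) (b∈ F.zero)) (InAdj-lincomb (λ i → c (F.suc i)) (λ i → b∈ (F.suc i)))

    InAdj-x· : ∀ {w} → InAdj L x w → InAdj L x (x · w)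
    InAdj-x· (f , refl) = 0ℚ ∷ₗ f , solve 2 (λ x p → x :* p := con 0ℚ :+ x :* p) refl x (evalPoly L f x)

    InAdj-pow : ∀ k → InAdj L x (pow L x k)
    InAdj-pow zero    = 1ℚ ∷ₗ []ₗ , sym (trans (cong (ι 1ℚ ⊕_) (zeroʳ x)) (trans (+-identityʳ (ι 1ℚ)) ι-1))
    InAdj-pow (suc k) = InAdj-x· (InAdj-pow k)

    InAdj⇒∈span : ∀ {n} {b : Fin n → V} {w} → one ∈span b → (∀ i → (x · b i) ∈span b) → InAdj L x w → w ∈span b
    InAdj⇒∈span {b = b} one∈b xb⊆b (f , refl) = go f
      where
      go : ∀ f → evalPoly L f x ∈span b
      go []ₗ      = 𝟘∈span b
      go (c ∷ₗ f) = ∈span-⊕ (∈span-• c one∈b) (∈span-· x xb⊆b (go f))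

  -- x^(n-1), …, x, 1: the highest power comes first, so that adjoining the next power is a cons.
  powersDesc : ∀ n → V → Fin n → V
  powersDesc zero    x = []
  powersDesc (suc n) x = pow L x n ∷ powersDesc n x

  x·powersDesc : ∀ n x j → x · powersDesc n x j ≡ powersDesc (suc n) x (F.inject₁ j)
  x·powersDesc (suc n) x F.zero    = refl
  x·powersDesc (suc n) x (F.suc j) = x·powersDesc n x j

  powersDesc-last : ∀ n x → powersDesc (suc n) x (F.fromℕ n) ≡ one
  powersDesc-last zero    x = refl
  powersDesc-last (suc n) x = powersDesc-last n x

  powersDesc-closed : ∀ n {x} → pow L x n ∈span powersDesc n x → ∀ i → (x · powersDesc n x i) ∈span powersDesc n x
  powersDesc-closed (suc n) xⁿ∈ F.zero    = xⁿ∈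
  powersDesc-closed (suc n) {x} xⁿ∈ (F.suc j) =
    subst (_∈span powersDesc (suc n) x) (sym (x·powersDesc n x j)) (∈span-member (powersDesc (suc n) x) (F.inject₁ j))

  InAdj-powersDesc : ∀ n x i → InAdj L x (powersDesc n x i)
  InAdj-powersDesc (suc n) x F.zero    = InAdj-pow n
  InAdj-powersDesc (suc n) x (F.suc i) = InAdj-powersDesc n x i

  irrational⇒powers-independent : ∀ {v} → ¬ IsRational L v → LinIndep L (powersDesc 2 v)
  irrational⇒powers-independent {v} v∉ℚ =
    irrational⇒independent {v · one} λ (q , v·one≡q) → v∉ℚ (q , trans (sym (*-identityʳ v)) v·one≡q)

  dim-ℚ[x] : ∀ n {x} → LinIndep L (powersDesc (suc n) x) → pow L x (suc n) ∈span powersDesc (suc n) x →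
             HasDim L (InAdj L x) (suc n)
  dim-ℚ[x] n {x} independent closed =
    powersDesc (suc n) x , InAdj-powersDesc (suc n) x , independent ,
    λ w w∈ℚ[x] → let span c w≡ = InAdj⇒∈span one∈ (powersDesc-closed (suc n) closed) w∈ℚ[x] in c , w≡
    where
    one∈ : one ∈span powersDesc (suc n) x
    one∈ = subst (_∈span powersDesc (suc n) x) (powersDesc-last n x) (∈span-member (powersDesc (suc n) x) (F.fromℕ n))

  primitive-if-basis : ∀ {α} (b : Fin 4 → V) → LinIndep L b → (∀ i → InAdj L α (b i)) → Primitive L α
  primitive-if-basis b independent b∈ℚ[α] w = let span c w≡ = independent⇒spanning b independent w in
    subst (InAdj L _) (sym w≡) (InAdj-lincomb c b∈ℚ[α])

  module _ (α : V) where

    powers : Fin 4 → V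
    powers i = pow L α (F.toℕ i)

    DegWrt-self : DegWrt L α α 1
    DegWrt-self = unitCoeffs (F.suc F.zero) , α≡ , F.suc F.zero , refl , (λ ()) , higher
      where
      α≡ : α ≡ lincomb (unitCoeffs (F.suc F.zero)) powers
      α≡ = trans (sym (*-identityʳ α)) (_∈span_.expansion (∈span-member powers (F.suc F.zero)))
      higher : ∀ j → 1 ℕ.< F.toℕ j → unitCoeffs (F.suc F.zero) j ≡ 0ℚ
      higher (F.suc F.zero)                 (s≤s ())
      higher (F.suc (F.suc F.zero))         _ = refl
      higher (F.suc (F.suc (F.suc F.zero))) _ = refl

    DegWrt-square : ∀ {v} → ¬ IsRational L v → v ∈span ((α · α) ∷ one ∷ []) → DegWrt L α v 2
    DegWrt-square {v} v∉ℚ (span e v≡) =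
      d , trans v≡ (lincomb-substitute square-one⊆powers e) , F.suc (F.suc F.zero) , refl , d₂≢0 , higher
      where
      square-one⊆powers : ∀ i → ((α · α) ∷ one ∷ []) i ∈span powers
      square-one⊆powers F.zero        = span (unitCoeffs (F.suc (F.suc F.zero)))
        (trans (cong (α ·_) (sym (*-identityʳ α))) (_∈span_.expansion (∈span-member powers (F.suc (F.suc F.zero)))))
      square-one⊆powers (F.suc F.zero) = ∈span-member powers F.zero
      d = λ j → sum (λ i → e i * _∈span_.coefficients (square-one⊆powers i) j)
      e₀≢0 : e F.zero ≢ 0ℚ
      e₀≢0 e₀≡0 = v∉ℚ (e (F.suc F.zero) , (begin
        v
          ≡⟨ trans v≡ (lincomb-x-one (α · α) e) ⟩
        (ι (e F.zero) · (α · α)) ⊕ ι (e (F.suc F.zero))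
          ≡⟨ cong (λ q → (ι q · (α · α)) ⊕ ι (e (F.suc F.zero))) e₀≡0 ⟩
        (ι 0ℚ · (α · α)) ⊕ ι (e (F.suc F.zero))
          ≡⟨ solve 2 (λ x y → con 0ℚ :* x :+ y := y) refl (α · α) (ι (e (F.suc F.zero))) ⟩
        ι (e (F.suc F.zero)) ∎))
      e₁-term≡0 : e (F.suc F.zero) * 0ℚ + 0ℚ ≡ 0ℚ
      e₁-term≡0 = trans (QP.+-identityʳ (e (F.suc F.zero) * 0ℚ)) (QP.*-zeroʳ (e (F.suc F.zero)))
      d₂≢0 : d (F.suc (F.suc F.zero)) ≢ 0ℚ
      d₂≢0 = e₀≢0 ∘ trans (sym (trans (cong₂ _+_ (QP.*-identityʳ (e F.zero)) e₁-term≡0) (QP.+-identityʳ (e F.zero))))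
      higher : ∀ j → 2 ℕ.< F.toℕ j → d j ≡ 0ℚ
      higher (F.suc F.zero)                 (s≤s ())
      higher (F.suc (F.suc F.zero))         (s≤s (s≤s ()))
      higher (F.suc (F.suc (F.suc F.zero))) _ = cong₂ _+_ (QP.*-zeroʳ (e F.zero)) e₁-term≡0

  -- The cases [ℚ(v) : ℚ] = 4, 3, 2

  PrimitiveRealisingIndex : V → Set
  PrimitiveRealisingIndex v = ∃ λ α → Primitive L α × ∃ λ e → FieldIndex L v e × DegWrt L α v e

  quartic-case : ∀ v → LinIndep L (powersDesc 4 v) → PrimitiveRealisingIndex v
  quartic-case v independent =
    v , primitive-if-basis (powersDesc 4 v) independent (InAdj-powersDesc 4 v) ,
    1 , (4 , dim-ℚ[x] 3 independent (independent⇒spanning (powersDesc 4 v) independent (pow L v 4)) , refl) ,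
    DegWrt-self v

  sub-scalar-· : ∀ x w C k → x · w ≡ (C · w) ⊕ k → (x ⊕ (⊖ C)) · w ≡ k
  sub-scalar-· x w C k xw≡ =
    ≡-modulo xw≡ one (solve 4 (λ x C w k → (x :- C) :* w := k :+ 𝟏 :* (x :* w :- (C :* w :+ k))) refl x C w k)

  -- x acts on L/A as multiplication by some c₀ ∈ ℚ, so (x - c₀)·L ⊆ A; an invertible x - c₀ would map
  -- a basis of L into the 3-dimensional A.
  rational-if-invariant-hyperplane : ∀ {x} (a : Fin 3 → V) → LinIndep L a → (∀ i → (x · a i) ∈span a) → IsRational L x
  rational-if-invariant-hyperplane {x} a independent invariant = complement (∃∉span a ≤-refl independent)
    where
    complement : ∃[ w ] ¬ w ∈span a → IsRational L x
    complement (w , w∉a) = shift (independent⇒spanning (w ∷ a) wa-independent (x · w))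
      where
      wa-independent : LinIndep L (w ∷ a)
      wa-independent = ∉span⇒independent-cons {a = a} independent w∉a
      shift : (x · w) ∈span (w ∷ a) → IsRational L x
      shift (span c xw≡) = decide ((x ⊕ (⊖ ι c₀)) ≟ᵛ 𝟘)
        where
        c₀ = c F.zero
        k = lincomb (λ i → c (F.suc i)) a
        shifted⊆a : ∀ i → ((x ⊕ (⊖ ι c₀)) · (w ∷ a) i) ∈span a
        shifted⊆a F.zero    = subst (_∈span a) (sym (sub-scalar-· x w (ι c₀) k (trans xw≡ (cong (_⊕ k) (•≡ι· c₀ w)))))
                                (span (λ i → c (F.suc i)) refl)
        shifted⊆a (F.suc j) = subst (_∈span a) xaⱼ-c₀aⱼ≡ (∈span-⊕ (invariant j) (∈span-ι· (- c₀) (∈span-member a j)))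
          where
          xaⱼ-c₀aⱼ≡ : (x · a j) ⊕ (ι (- c₀) · a j) ≡ (x ⊕ (⊖ ι c₀)) · a j
          xaⱼ-c₀aⱼ≡ = trans (cong (λ y → (x · a j) ⊕ (y · a j)) (ι-‿ c₀))
                             (solve 3 (λ x C y → x :* y :+ (:- C) :* y := (x :- C) :* y) refl x (ι c₀) (a j))
        decide : Dec (x ⊕ (⊖ ι c₀) ≡ 𝟘) → IsRational L x
        decide (yes x-c₀≡0) = c₀ , x⊖y≡𝟘⇒x≡y x-c₀≡0
        decide (no x-c₀≢0)  =
          ⊥-elim (independent-⊈-smaller-span (λ i → (x ⊕ (⊖ ι c₀)) · (w ∷ a) i) a ≤-refl shifted-independent shifted⊆a)
          where
          shifted-independent : LinIndep L (λ i → (x ⊕ (⊖ ι c₀)) · (w ∷ a) i)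
          shifted-independent d ≡0 = wa-independent d (·-integral x-c₀≢0 (trans (·-lincomb (x ⊕ (⊖ ι c₀)) d (w ∷ a)) ≡0))

  no-cubic-case : ∀ {v} → ¬ IsRational L v → LinIndep L (powersDesc 3 v) → ¬ pow L v 3 ∈span powersDesc 3 v
  no-cubic-case {v} v∉ℚ independent v³∈ =
    v∉ℚ (rational-if-invariant-hyperplane (powersDesc 3 v) independent (powersDesc-closed 3 {v} v³∈))

  module QuadraticSubfield (s : V) (D : ℚ) (s²≡D : s · s ≡ ι D) (s∉ℚ : ¬ IsRational L s) where

    K : Fin 2 → V
    K = s ∷ one ∷ []

    K-independent : LinIndep L K
    K-independent = irrational⇒independent s∉ℚ

    ∈K : ∀ a b → ((ι a · s) ⊕ ι b) ∈span K
    ∈K a b = span (a ∷ b ∷ []) (sym (lincomb-x-one s (a ∷ b ∷ [])))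

    D-nonsquare : ∀ a → D ≢ a * a
    D-nonsquare a D≡a² = s∉ℚ (root ((s ⊕ (⊖ ι a)) ≟ᵛ 𝟘))
      where
      product≡0 : (s ⊕ (⊖ ι a)) · (s ⊕ ι a) ≡ 𝟘
      product≡0 = begin
        (s ⊕ (⊖ ι a)) · (s ⊕ ι a)
          ≡⟨ solve 2 (λ s A → (s :- A) :* (s :+ A) := s :* s :- A :* A) refl s (ι a) ⟩
        (s · s) ⊕ (⊖ (ι a · ι a))
          ≡⟨ cong (λ y → y ⊕ (⊖ (ι a · ι a))) (trans s²≡D (trans (cong ι D≡a²) (ι-* a a))) ⟩
        (ι a · ι a) ⊕ (⊖ (ι a · ι a))
          ≡⟨ -‿inverseʳ (ι a · ι a) ⟩
        𝟘 ∎
      root : Dec ((s ⊕ (⊖ ι a)) ≡ 𝟘) → IsRational L s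
      root (yes s-a≡0) = a , x⊖y≡𝟘⇒x≡y s-a≡0
      root (no s-a≢0)  = - a , trans (x⊕y≡𝟘⇒x≡⊖y (·-integral s-a≢0 product≡0)) (sym (ι-‿ a))

    s·K⊆K : ∀ i → (s · K i) ∈span K
    s·K⊆K F.zero         =
      subst (_∈span K) (trans (solve 2 (λ s D → con 0ℚ :* s :+ D := D) refl s (ι D)) (sym s²≡D)) (∈K 0ℚ D)
    s·K⊆K (F.suc F.zero) =
      subst (_∈span K) (solve 1 (λ s → con 1ℚ :* s :+ con 0ℚ := s :* 𝟏) refl s) (∈K 1ℚ 0ℚ)

    K-closed : ∀ {x y} → x ∈span K → y ∈span K → (x · y) ∈span K
    K-closed {x} {y} x∈K y∈K = ∈span-· x x·K⊆K y∈K
      where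
      x·K⊆K : ∀ i → (x · K i) ∈span K
      x·K⊆K F.zero        = subst (_∈span K) (·-comm s x) (∈span-· s s·K⊆K x∈K)
      x·K⊆K (F.suc F.zero) = subst (_∈span K) (sym (*-identityʳ x)) x∈K

    -- From s·z = a·z + k one gets (D - a²)·z = a·k + s·k ∈ K, and D - a² ≠ 0.
    ∉K⇒independent : ∀ {z} → ¬ z ∈span K → LinIndep L ((s · z) ∷ z ∷ K)
    ∉K⇒independent {z} z∉K =
      ∉span⇒independent-cons {a = z ∷ K} (∉span⇒independent-cons {a = K} K-independent z∉K) sz∉
      where
      sz∉ : ¬ (s · z) ∈span (z ∷ K)
      sz∉ (span c sz≡c) = z∉K (divide ((D - a * a) ≟ 0ℚ))
        where
        a = c F.zero
        k = lincomb (λ i → c (F.suc i)) K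
        k∈K : k ∈span K
        k∈K = span (λ i → c (F.suc i)) refl
        sz≡ : s · z ≡ (ι a · z) ⊕ k
        sz≡ = trans sz≡c (cong (_⊕ k) (•≡ι· a z))
        Nz≡ : ι (D - a * a) · z ≡ (ι a · k) ⊕ (s · k)
        Nz≡ = begin
          ι (D - a * a) · z
            ≡⟨ cong (_· z) (trans (ι-sub D (a * a)) (cong₂ (λ d e → d ⊕ (⊖ e)) (sym s²≡D) (ι-* a a))) ⟩
          ((s · s) ⊕ (⊖ (ι a · ι a))) · z
            ≡⟨ ≡-modulo sz≡ (s ⊕ ι a) (solve 4 (λ s A z k →
                 (s :* s :- A :* A) :* z := (A :* k :+ s :* k) :+ (s :+ A) :* (s :* z :- (A :* z :+ k))) refl s (ι a) z k) ⟩
          (ι a · k) ⊕ (s · k) ∎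
        divide : Dec (D - a * a ≡ 0ℚ) → z ∈span K
        divide (yes N≡0) = ⊥-elim (D-nonsquare a (p-q≡0⇒p≡q D (a * a) N≡0))
        divide (no N≢0)  = subst (_∈span K) (ι-cancel (D - a * a) z)
          (∈span-ι· (1/ (D - a * a)) (subst (_∈span K) (sym Nz≡) (∈span-⊕ (∈span-ι· a k∈K) (∈span-· s s·K⊆K k∈K))))
          where instance _ = ≢-nonZero N≢0

    ∃∉K-with-square∈K : ∃[ t ] ¬ t ∈span K × (t · t) ∈span K
    ∃∉K-with-square∈K = outside (∃∉span K (s≤s (s≤s (s≤s z≤n))) K-independent)
      where
      outside : ∃[ w ] ¬ w ∈span K → ∃[ t ] ¬ t ∈span K × (t · t) ∈span K
      outside (w , w∉K) = complete (independent⇒spanning ((s · w) ∷ w ∷ K) (∉K⇒independent w∉K) (w · w))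
        where
        -- w² = c₀·sw + c₁·w + k with k ∈ K; completing the square, t = w - (c₀ s + c₁)/2 has t² ∈ K.
        complete : (w · w) ∈span ((s · w) ∷ w ∷ K) → ∃[ t ] ¬ t ∈span K × (t · t) ∈span K
        complete (span c w²≡c) =
          w ⊕ (⊖ m) , t∉K , subst (_∈span K) (sym t²≡) (∈span-⊕ k∈K (K-closed m∈K m∈K))
          where
          C₀ = ι (c F.zero)
          C₁ = ι (c (F.suc F.zero))
          k = lincomb (λ i → c (F.suc (F.suc i))) K
          k∈K : k ∈span K
          k∈K = span (λ i → c (F.suc (F.suc i))) refl
          w²≡ : w · w ≡ (C₀ · (s · w)) ⊕ ((C₁ · w) ⊕ k)
          w²≡ = trans w²≡c (cong₂ _⊕_ (•≡ι· (c F.zero) (s · w)) (cong (_⊕ k) (•≡ι· (c (F.suc F.zero)) w)))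
          m = ι ½ · ((C₀ · s) ⊕ C₁)
          m∈K : m ∈span K
          m∈K = ∈span-ι· ½ (∈K (c F.zero) (c (F.suc F.zero)))
          t²≡ : (w ⊕ (⊖ m)) · (w ⊕ (⊖ m)) ≡ k ⊕ (m · m)
          t²≡ = ≡-modulo w²≡ one (solve 5 (λ w s k C₀ C₁ → let m = con ½ :* (C₀ :* s :+ C₁) in
                  (w :- m) :* (w :- m) := (k :+ m :* m) :+ 𝟏 :* (w :* w :- (C₀ :* (s :* w) :+ (C₁ :* w :+ k))))
                refl w s k C₀ C₁)
          t∉K : ¬ (w ⊕ (⊖ m)) ∈span K
          t∉K t∈K = w∉K (subst (_∈span K) (solve 2 (λ w m → (w :- m) :+ m := w) refl w m) (∈span-⊕ t∈K m∈K))

    s∈span-square : ∀ α y x → y ≢ 0ℚ → α · α ≡ (ι y · s) ⊕ ι x → s ∈span ((α · α) ∷ one ∷ [])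
    s∈span-square α y x y≢0 α²≡ = span (1/ y ∷ - (1/ y * x) ∷ []) (sym (begin
      lincomb (1/ y ∷ - (1/ y * x) ∷ []) ((α · α) ∷ one ∷ [])
        ≡⟨ lincomb-x-one (α · α) (1/ y ∷ - (1/ y * x) ∷ []) ⟩
      (ι (1/ y) · (α · α)) ⊕ ι (- (1/ y * x))
        ≡⟨ cong ((ι (1/ y) · (α · α)) ⊕_) (trans (ι-‿ (1/ y * x)) (cong ⊖_ (ι-* (1/ y) x))) ⟩
      (ι (1/ y) · (α · α)) ⊕ (⊖ (ι (1/ y) · ι x))
        ≡⟨ ≡-modulo α²≡ (ι (1/ y)) (solve 5 (λ Yi Y X s a →
             Yi :* (a :* a) :- Yi :* X := (Yi :* Y) :* s :+ Yi :* (a :* a :- (Y :* s :+ X))) refl (ι (1/ y)) (ι y) (ι x) s α) ⟩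
      (ι (1/ y) · ι y) · s
        ≡⟨ cong (_· s) (ι-inverse y) ⟩
      one · s
        ≡⟨ ·-unit s ⟩
      s ∎))
      where instance _ = ≢-nonZero y≢0

    -- (1 - s)·(t + t s) = (1 - D)·t, and 1 - D ≠ 0 since D is not a square.
    twist-∉K : ∀ t → ¬ t ∈span K → ¬ (t ⊕ (t · s)) ∈span K
    twist-∉K t t∉K twist∈K = t∉K (subst (_∈span K) (ι-cancel (1ℚ - D) t)
      (∈span-ι· (1/ (1ℚ - D)) (subst (_∈span K) (sym shifted≡) (K-closed 1-s∈K twist∈K))))
      where
      1-D≢0 : 1ℚ - D ≢ 0ℚ
      1-D≢0 1-D≡0 = D-nonsquare 1ℚ (sym (p-q≡0⇒p≡q 1ℚ D 1-D≡0))
      instance _ = ≢-nonZero 1-D≢0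
      1-s∈K : (one ⊕ (⊖ s)) ∈span K
      1-s∈K = subst (_∈span K) (solve 1 (λ s → con (- 1ℚ) :* s :+ con 1ℚ := 𝟏 :- s) refl s) (∈K (- 1ℚ) 1ℚ)
      shifted≡ : ι (1ℚ - D) · t ≡ (one ⊕ (⊖ s)) · (t ⊕ (t · s))
      shifted≡ = begin
        ι (1ℚ - D) · t
          ≡⟨ cong (_· t) (trans (ι-sub 1ℚ D) (cong (_⊕ (⊖ ι D)) ι-1)) ⟩
        (one ⊕ (⊖ ι D)) · t
          ≡⟨ ≡-modulo s²≡D t (solve 3 (λ t s D → (𝟏 :- D) :* t := (𝟏 :- s) :* (t :+ t :* s) :+ t :* (s :* s :- D))
                                       refl t s (ι D)) ⟩
        (one ⊕ (⊖ s)) · (t ⊕ (t · s)) ∎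

    twist-square : ∀ t x → t · t ≡ ι x →
                   (t ⊕ (t · s)) · (t ⊕ (t · s)) ≡ (ι ((1ℚ + 1ℚ) * x) · s) ⊕ ι (x + x * D)
    twist-square t x t²≡x = begin
      (t ⊕ (t · s)) · (t ⊕ (t · s))
        ≡⟨ solve 2 (λ t s → (t :+ t :* s) :* (t :+ t :* s) := (t :* t) :* ((𝟏 :+ s) :* (𝟏 :+ s))) refl t s ⟩
      (t · t) · ((one ⊕ s) · (one ⊕ s))
        ≡⟨ cong (_· ((one ⊕ s) · (one ⊕ s))) t²≡x ⟩
      ι x · ((one ⊕ s) · (one ⊕ s))
        ≡⟨ ≡-modulo s²≡D (ι x) (solve 3 (λ X s D →
             X :* ((𝟏 :+ s) :* (𝟏 :+ s)) := ((con (1ℚ + 1ℚ) :* X) :* s :+ (X :+ X :* D)) :+ X :* (s :* s :- D)) refl (ι x) s (ι D)) ⟩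
      ((ι (1ℚ + 1ℚ) · ι x) · s) ⊕ (ι x ⊕ (ι x · ι D))
        ≡⟨ cong₂ (λ p q → (p · s) ⊕ q) (sym (ι-* (1ℚ + 1ℚ) x))
                 (trans (cong (ι x ⊕_) (sym (ι-* x D))) (sym (ι-+ x (x * D)))) ⟩
      (ι ((1ℚ + 1ℚ) * x) · s) ⊕ ι (x + x * D) ∎

    ∃∉K-with-s∈span-square : ∃[ α ] ¬ α ∈span K × s ∈span ((α · α) ∷ one ∷ [])
    ∃∉K-with-s∈span-square = from-square ∃∉K-with-square∈K
      where
      from-square : ∃[ t ] ¬ t ∈span K × (t · t) ∈span K → ∃[ α ] ¬ α ∈span K × s ∈span ((α · α) ∷ one ∷ [])
      from-square (t , t∉K , span c t²≡c) = choose (c F.zero ≟ 0ℚ)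
        where
        x = c (F.suc F.zero)
        t²≡ : t · t ≡ (ι (c F.zero) · s) ⊕ ι x
        t²≡ = trans t²≡c (lincomb-x-one s c)
        choose : Dec (c F.zero ≡ 0ℚ) → ∃[ α ] ¬ α ∈span K × s ∈span ((α · α) ∷ one ∷ [])
        choose (no y≢0)  = t , t∉K , s∈span-square t (c F.zero) x y≢0 t²≡
        choose (yes y≡0) =
          t ⊕ (t · s) , twist-∉K t t∉K ,
          s∈span-square (t ⊕ (t · s)) ((1ℚ + 1ℚ) * x) (x + x * D) 2x≢0 (twist-square t x t²≡x)
          where
          t²≡x : t · t ≡ ι x
          t²≡x = trans t²≡ (trans (cong (λ y → (ι y · s) ⊕ ι x) y≡0)
                                  (solve 2 (λ s X → con 0ℚ :* s :+ X := X) refl s (ι x)))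
          x≢0 : x ≢ 0ℚ
          x≢0 x≡0 = t∉K (subst (_∈span K) (sym (square≡𝟘⇒≡𝟘 (trans t²≡x (trans (cong ι x≡0) ι-0)))) (𝟘∈span K))
          2x≢0 : (1ℚ + 1ℚ) * x ≢ 0ℚ
          2x≢0 2x≡0 = 2≢0 (*-cancelʳ-≡0 x≢0 2x≡0)
            where
            2≢0 : 1ℚ + 1ℚ ≢ 0ℚ
            2≢0 ()

    K⊆span-square : ∀ α → s ∈span ((α · α) ∷ one ∷ []) → ∀ i → K i ∈span ((α · α) ∷ one ∷ [])
    K⊆span-square α s∈α² F.zero         = s∈α²
    K⊆span-square α s∈α² (F.suc F.zero) = ∈span-member ((α · α) ∷ one ∷ []) (F.suc F.zero)

    primitive-if-∉K : ∀ α → ¬ α ∈span K → s ∈span ((α · α) ∷ one ∷ []) → Primitive L α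
    primitive-if-∉K α α∉K (span e s≡) =
      primitive-if-basis ((s · α) ∷ α ∷ K) (∉K⇒independent α∉K) basis∈ℚ[α]
      where
      α∈ℚ[α] : InAdj L α α
      α∈ℚ[α] = subst (InAdj L α) (*-identityʳ α) (InAdj-pow 1)
      s∈ℚ[α] : InAdj L α s
      s∈ℚ[α] = subst (InAdj L α) (sym s≡)
        (InAdj-lincomb e {(α · α) ∷ one ∷ []} λ { F.zero → InAdj-x· α∈ℚ[α] ; (F.suc F.zero) → InAdj-pow 0 })
      basis∈ℚ[α] : ∀ i → InAdj L α (((s · α) ∷ α ∷ K) i)
      basis∈ℚ[α] F.zero                         = subst (InAdj L α) (·-comm α s) (InAdj-x· s∈ℚ[α])
      basis∈ℚ[α] (F.suc F.zero)                 = α∈ℚ[α]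
      basis∈ℚ[α] (F.suc (F.suc F.zero))         = s∈ℚ[α]
      basis∈ℚ[α] (F.suc (F.suc (F.suc F.zero))) = InAdj-pow 0

  centre-square : ∀ v r₀ r₁ → v · v ≡ (ι r₀ · v) ⊕ ι r₁ →
                  (v ⊕ (⊖ (ι ½ · ι r₀))) · (v ⊕ (⊖ (ι ½ · ι r₀))) ≡ ι (r₁ + (½ * r₀) * (½ * r₀))
  centre-square v r₀ r₁ v²≡ = begin
    (v ⊕ (⊖ H)) · (v ⊕ (⊖ H))
      ≡⟨ ≡-modulo v²≡ one (solve 3 (λ v R₀ R₁ → let H = con ½ :* R₀ in
           (v :- H) :* (v :- H) := (R₁ :+ H :* H) :+ 𝟏 :* (v :* v :- (R₀ :* v :+ R₁))) refl v (ι r₀) (ι r₁)) ⟩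
    ι r₁ ⊕ (H · H)
      ≡⟨ cong (ι r₁ ⊕_) (trans (ι-* (½ * r₀) (½ * r₀)) (cong₂ _·_ (ι-* ½ r₀) (ι-* ½ r₀))) ⟨
    ι r₁ ⊕ ι ((½ * r₀) * (½ * r₀))
      ≡⟨ ι-+ r₁ ((½ * r₀) * (½ * r₀)) ⟨
    ι (r₁ + (½ * r₀) * (½ * r₀)) ∎
    where H = ι ½ · ι r₀

  quadratic-case : ∀ v → ¬ IsRational L v → pow L v 2 ∈span powersDesc 2 v → PrimitiveRealisingIndex v
  quadratic-case v v∉ℚ v²∈@(span r v²≡r) = build ∃∉K-with-s∈span-square
    where
    r₀ = r F.zero
    r₁ = r (F.suc F.zero)
    v²≡ : v · v ≡ (ι r₀ · v) ⊕ ι r₁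
    v²≡ = begin
      v · v                         ≡⟨ cong (v ·_) (*-identityʳ v) ⟨
      v · (v · one)                 ≡⟨ v²≡r ⟩
      lincomb r (powersDesc 2 v)    ≡⟨ lincomb-x-one (v · one) r ⟩
      (ι r₀ · (v · one)) ⊕ ι r₁     ≡⟨ cong (λ y → (ι r₀ · y) ⊕ ι r₁) (*-identityʳ v) ⟩
      (ι r₀ · v) ⊕ ι r₁             ∎
    s = v ⊕ (⊖ (ι ½ · ι r₀))
    v≡s+r₀/2 : v ≡ s ⊕ ι (½ * r₀)
    v≡s+r₀/2 = trans (solve 2 (λ v H → v := (v :- H) :+ H) refl v (ι ½ · ι r₀)) (cong (s ⊕_) (sym (ι-* ½ r₀)))
    s∉ℚ : ¬ IsRational L s
    s∉ℚ (q , s≡q) = v∉ℚ (q + ½ * r₀ , trans v≡s+r₀/2 (trans (cong (_⊕ ι (½ * r₀)) s≡q) (sym (ι-+ q (½ * r₀)))))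
    open QuadraticSubfield s (r₁ + (½ * r₀) * (½ * r₀)) (centre-square v r₀ r₁ v²≡) s∉ℚ
    v∈K : v ∈span K
    v∈K = subst (_∈span K) (trans (cong (_⊕ ι (½ * r₀)) (trans (cong (_· s) ι-1) (·-unit s))) (sym v≡s+r₀/2))
                (∈K 1ℚ (½ * r₀))
    build : ∃[ α ] ¬ α ∈span K × s ∈span ((α · α) ∷ one ∷ []) → PrimitiveRealisingIndex v
    build (α , α∉K , s∈α²) =
      α , primitive-if-∉K α α∉K s∈α² ,
      2 , (2 , dim-ℚ[x] 1 (irrational⇒powers-independent v∉ℚ) v²∈ , refl) ,
      DegWrt-square α v∉ℚ (∈span-trans (K⊆span-square α s∈α²) v∈K)

open LinearAlgebra using (∈span?; ∉span⇒independent-cons)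

theorem3p1 : (L : QuarticField) → IsGalois L →
    ∀ v → ¬ IsRational L v →
    ∃ λ α → Primitive L α × ∃ λ e → FieldIndex L v e × DegWrt L α v e
theorem3p1 L _ v v∉ℚ = by-degree (∈span? L independent₂ (pow L v 2))
  where
  independent₂ = irrational⇒powers-independent L v∉ℚ
  by-degree : Dec (pow L v 2 ∈span powersDesc L 2 v) → PrimitiveRealisingIndex L v
  by-degree (yes v²∈) = quadratic-case L v v∉ℚ v²∈
  by-degree (no v²∉)  = not-cubic (∈span? L independent₃ (pow L v 3))
    where
    independent₃ = ∉span⇒independent-cons L {a = powersDesc L 2 v} independent₂ v²∉
    not-cubic : Dec (pow L v 3 ∈span powersDesc L 3 v) → PrimitiveRealisingIndex L v
    not-cubic (yes v³∈) = ⊥-elim (no-cubic-case L v∉ℚ independent₃ v³∈)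
    not-cubic (no v³∉)  = quartic-case L v (∉span⇒independent-cons L {a = powersDesc L 3 v} independent₃ v³∉)
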